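{- Let $G$ be a finite connected graph with radius $r$ and diameter at most $2r-2$. Then $G$ contains a cycle of length at least $4$, i.e. $c(G)\geq 4$.
   Context: Graphs are finite, simple and undirected. For a connected graph $G$, $d(u,v)$ is the length of a shortest $u$–$v$ path. The eccentricity of a vertex $u$ is $e(u)=\max\{d(u,v): v\in V(G)\}$. The radius of $G$ is the minimum eccentricity over all vertices. The diameter of $G$ is the maximum eccentricity over all vertices. The circumference $c(G)$ is the length of a longest cycle in $G$. -}

module Defs where

open import Level using (0ℓ)
open import Data.Nat using (ℕ; zero; suc; _≤_; _+_)
open import Data.Fin using (Fin)
open import Data.List using (List; _∷_; []; length; _∷ʳ_)
open import Data.List.Relation.Unary.Unique.Propositional using (Unique)
open import Data.List.Relation.Binary.Pointwise using ()
open import Data.List.Relation.Unary.Linked using (Linked)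
open import Data.Product using (Σ; ∃; _×_; _,_)
open import Relation.Nullary using (¬_; Dec)
open import Relation.Binary.PropositionalEquality using (_≡_)

record Graph (n : ℕ) : Set₁ where
  field
    Adj     : Fin n → Fin n → Set
    adj?    : ∀ u v → Dec (Adj u v)
    sym     : ∀ {u v} → Adj u v → Adj v u
    irrefl  : ∀ {u} → ¬ Adj u u
open Graph public

module _ {n : ℕ} (G : Graph n) where

  data Walk : Fin n → Fin n → ℕ → Set where
    here : ∀ {u} → Walk u u zero
    step : ∀ {u w v k} → Adj G u w → Walk w v k → Walk u v (suc k)

  Connected : Set
  Connected = ∀ u v → ∃ λ k → Walk u v k

  Dist : Fin n → Fin n → ℕ → Set
  Dist u v k = Walk u v k × (∀ j → Walk u v j → k ≤ j)

  Ecc : Fin n → ℕ → Set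
  Ecc u k = (∀ v j → Dist u v j → j ≤ k) × (∃ λ v → Dist u v k)

  Radius : ℕ → Set
  Radius r = (∃ λ u → Ecc u r) × (∀ u k → Ecc u k → r ≤ k)


  -- Its length is the number of vertices (= number of edges).
  record Cycle : Set where
    field
      start    : Fin n
      rest     : List (Fin n)
      distinct : Unique (start ∷ rest)
      enough   : 3 ≤ length (start ∷ rest)
      closed   : Linked (Adj G) ((start ∷ rest) ∷ʳ start)

  cycleLength : Cycle → ℕ
  cycleLength C = length (Cycle.start C ∷ Cycle.rest C)

  CircumferenceAtLeast : ℕ → Set
  CircumferenceAtLeast m = Σ Cycle λ C → m ≤ cycleLength C

-- Let x be a vertex of maximum eccentricity D and y a vertex at distance D
-- from x.  Since r ≤ D ≤ 2r − 2, a shortest x–y path has an inner vertex m,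
-- with neighbours a and c on the path, such that d(x,m) < r and d(m,y) < r.
-- A vertex z farthest from m has d(m,z) ≥ r, so shortest x–z and y–z paths
-- are too short to pass through m, and so are the two halves of the x–y path.
-- Hence a and c are joined in G − m; as they are distinct and non-adjacent,
-- a shortest a–c path in G − m closed up through m is a cycle of length ≥ 4.
module Submission where

open import Defs
open import Data.Nat using (ℕ; zero; suc; _+_; _*_; _≤_; _<_; z≤n; s≤s; s≤s⁻¹; ⌊_/2⌋; ⌈_/2⌉)
open import Data.Nat.Properties
open import Data.Nat.Induction using (<-wellFounded)
open import Data.Nat.Tactic.RingSolver using (solve-∀)
open import Data.Fin using (Fin)
open import Data.Fin.Properties using (any?) renaming (_≟_ to _≟ᶠ_)
open import Data.List using (List; []; _∷_; _∷ʳ_; length; allFin)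
open import Data.List.Extrema.Nat using (argmax; f[xs]≤f[argmax])
open import Data.List.Membership.Propositional using (_∈_)
open import Data.List.Membership.Propositional.Properties using (∈-allFin)
open import Data.List.Relation.Unary.All as All using (All; []; _∷_)
open import Data.List.Relation.Unary.All.Properties.Core using (¬Any⇒All¬)
open import Data.List.Relation.Unary.Any using (here; there)
open import Data.List.Relation.Unary.AllPairs using ([]; _∷_)
open import Data.List.Relation.Unary.Linked using (Linked; [-]; _∷_)
open import Data.List.Relation.Unary.Unique.Propositional using (Unique)
open import Data.Product using (∃; ∃₂; _×_; _,_; proj₁; proj₂)
open import Data.Sum using (_⊎_; inj₁; inj₂)
open import Data.Empty using (⊥-elim)
open import Function using (_∘_)
open import Induction.WellFounded using (Acc; acc)
open import Relation.Nullary using (¬_; Dec; yes; no; ¬?)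
open import Relation.Nullary.Decidable using (_×-dec_)
open import Relation.Unary using (Decidable)
open import Relation.Binary.PropositionalEquality as ≡ using (_≡_; _≢_; refl)

module _ {P : ℕ → Set} (P? : Decidable P) where

  least : ∀ {k} → P k → ∃ λ j → P j × (∀ i → P i → j ≤ i)
  least {k} = go k (<-wellFounded k)
    where
    go : ∀ k → Acc _<_ k → P k → ∃ λ j → P j × (∀ i → P i → j ≤ i)
    go k (acc rs) pk with anyUpTo? P? k
    ... | yes (i , i<k , pi) = go i (rs i<k) pi
    ... | no none            = k , pk , λ i pi → ≮⇒≥ λ i<k → none (i , i<k , pi)

balanced-split : ∀ {D r} → r ≤ D → D + 2 ≤ 2 * r →
                 ∃₂ λ p q → p + suc (suc q) ≡ D × suc p < r × suc q < r
balanced-split {zero}        z≤n       ()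
balanced-split {suc zero}    z≤n       ()
balanced-split {suc zero}    (s≤s z≤n) (s≤s (s≤s ()))
balanced-split {suc (suc s)} {r} _ D+2≤2r =
  ⌊ s /2⌋ , ⌈ s /2⌉ , halves , ≤-trans (s≤s (s≤s (⌊n/2⌋≤⌈n/2⌉ s))) q+1<r , q+1<r
  where
  open ≤-Reasoning

  halves : ⌊ s /2⌋ + suc (suc ⌈ s /2⌉) ≡ suc (suc s)
  halves = begin-equality
    ⌊ s /2⌋ + suc (suc ⌈ s /2⌉)  ≡⟨ +-suc _ _ ⟩
    suc (⌊ s /2⌋ + suc ⌈ s /2⌉)  ≡⟨ ≡.cong suc (+-suc _ _) ⟩
    suc (suc (⌊ s /2⌋ + ⌈ s /2⌉)) ≡⟨ ≡.cong (suc ∘ suc) (⌊n/2⌋+⌈n/2⌉≡n s) ⟩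
    suc (suc s)                   ∎

  q+1<r : 2 + ⌈ s /2⌉ ≤ r
  q+1<r = begin
    ⌈ 4 + s /2⌉     ≤⟨ ⌈n/2⌉-mono (≤-trans (≤-reflexive (≡.cong (2 +_) (+-comm 2 s))) D+2≤2r) ⟩
    ⌈ 2 * r /2⌉     ≡⟨ ≡.cong ⌈_/2⌉ (≡.cong (r +_) (+-identityʳ r)) ⟩
    ⌈ r + r /2⌉     ≡⟨ n≡⌈n+n/2⌉ r ⟨
    r               ∎

walk? : ∀ {n} (H : Graph n) u v k → Dec (Walk H u v k)
walk? H u v zero with u ≟ᶠ v
... | yes refl = yes here
... | no u≢v   = no λ { here → u≢v refl }
walk? H u v (suc k) with any? (λ w → adj? H u w ×-dec walk? H w v k)
... | yes (w , e , W) = yes (step e W)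
... | no none         = no λ { (step e W) → none (_ , e , W) }

module _ {n : ℕ} {H : Graph n} where

  infixr 5 _++ʷ_

  _++ʷ_ : ∀ {u w v i j} → Walk H u w i → Walk H w v j → Walk H u v (i + j)
  here       ++ʷ W′ = W′
  step e W   ++ʷ W′ = step e (W ++ʷ W′)

  reverseʷ : ∀ {u v k} → Walk H u v k → Walk H v u k
  reverseʷ here       = here
  reverseʷ (step e W) = ≡.subst (Walk H _ _) (+-comm _ 1) (reverseʷ W ++ʷ step (sym H e) here)

  splitAtʷ : ∀ i {j u v} → Walk H u v (i + j) → ∃ λ w → Walk H u w i × Walk H w v j
  splitAtʷ zero    W          = _ , here , W
  splitAtʷ (suc i) (step e W) with splitAtʷ i W
  ... | w , W₁ , W₂ = w , step e W₁ , W₂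

  shortest : ∀ {u v k} → Walk H u v k → ∃ (Dist H u v)
  shortest {u} {v} = least (walk? H u v)

  Dist-unique : ∀ {u v j k} → Dist H u v j → Dist H u v k → j ≡ k
  Dist-unique (W , W-min) (W′ , W′-min) = ≤-antisym (W-min _ W′) (W′-min _ W)

  vertices : ∀ {u v k} → Walk H u v k → List (Fin n)
  vertices {u} here       = u ∷ []
  vertices {u} (step e W) = u ∷ vertices W

  length-vertices : ∀ {u v k} (W : Walk H u v k) → length (vertices W) ≡ suc k
  length-vertices here       = refl
  length-vertices (step e W) = ≡.cong suc (length-vertices W)

  walk-from-vertex : ∀ {t u v k} (W : Walk H u v k) → t ∈ vertices W →
                     ∃ λ j → j ≤ k × Walk H t v j
  walk-from-vertex here       (here refl)  = 0 , z≤n , here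
  walk-from-vertex (step e W) (here refl)  = _ , ≤-refl , step e W
  walk-from-vertex (step e W) (there t∈W) with walk-from-vertex W t∈W
  ... | j , j≤k , W′ = j , m≤n⇒m≤1+n j≤k , W′

  shortest-unique : ∀ {u v k} (W : Walk H u v k) → (∀ j → Walk H u v j → k ≤ j) →
                    Unique (vertices W)
  shortest-unique here       _     = [] ∷ []
  shortest-unique (step e W) W-min =
    ¬Any⇒All¬ _ u∉W ∷ shortest-unique W λ j W′ → s≤s⁻¹ (W-min _ (step e W′))
    where
    u∉W : ¬ _ ∈ vertices W
    u∉W u∈W with walk-from-vertex W u∈W
    ... | j , j≤k , W′ = <⇒≱ (s≤s j≤k) (W-min j W′)

infixl 6 _∖_

_∖_ : ∀ {n} → Graph n → Fin n → Graph n
G ∖ m = record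
  { Adj    = λ u v → Adj G u v × u ≢ m × v ≢ m
  ; adj?   = λ u v → adj? G u v ×-dec (¬? (u ≟ᶠ m) ×-dec ¬? (v ≟ᶠ m))
  ; sym    = λ { (e , u≢m , v≢m) → sym G e , v≢m , u≢m }
  ; irrefl = λ { (e , _) → irrefl G e }
  }

module _ {n : ℕ} (G : Graph n) (m : Fin n) where

  avoid-or-through : ∀ {u v L} → Walk G u v L →
    (u ≢ m × Walk (G ∖ m) u v L) ⊎ ∃₂ λ i j → Walk G u m i × Walk G m v j × i + j ≡ L
  avoid-or-through {u} W with u ≟ᶠ m
  ... | yes refl = inj₂ (0 , _ , here , W , refl)
  avoid-or-through here       | no u≢m = inj₁ (u≢m , here)
  avoid-or-through (step e W) | no u≢m with avoid-or-through W
  ... | inj₁ (w≢m , W′)               = inj₁ (u≢m , step (e , u≢m , w≢m) W′)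
  ... | inj₂ (i , j , Wᵢ , Wⱼ , i+j≡L) = inj₂ (suc i , j , step e Wᵢ , Wⱼ , ≡.cong suc i+j≡L)

  avoid : ∀ {u v L} → Walk G u v L →
          (∀ {i j} → Walk G u m i → Walk G m v j → L < i + j) → Walk (G ∖ m) u v L
  avoid W detour-longer with avoid-or-through W
  ... | inj₁ (_ , W′)                  = W′
  ... | inj₂ (i , j , Wᵢ , Wⱼ , i+j≡L) = ⊥-elim (<⇒≢ (detour-longer Wᵢ Wⱼ) (≡.sym i+j≡L))

  avoids : ∀ {u v k} (W : Walk (G ∖ m) u v k) → u ≢ m → All (m ≢_) (vertices W)
  avoids here                       u≢m = (λ m≡u → u≢m (≡.sym m≡u)) ∷ []
  avoids (step (_ , u≢m , w≢m) W) _   = (λ m≡u → u≢m (≡.sym m≡u)) ∷ avoids W w≢m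

  linked-around : ∀ {t u v k} → Adj G t u → (W : Walk (G ∖ m) u v k) → Adj G v m →
                  Linked (Adj G) (t ∷ vertices W ∷ʳ m)
  linked-around t∼u here                 u∼m = t∼u ∷ u∼m ∷ [-]
  linked-around t∼u (step (u∼w , _) W) v∼m = t∼u ∷ linked-around u∼w W v∼m

  cycle-through : ∀ {a c k} → Adj G a m → Adj G m c → a ≢ c → ¬ Adj G a c →
                  Walk (G ∖ m) a c k → CircumferenceAtLeast G 4
  cycle-through {a} {c} a∼m m∼c a≢c a≁c W with shortest W
  ... | j , P , P-min = cycle , four≤length
    where
    a≢m : a ≢ m
    a≢m refl = irrefl G a∼m

    two≤ : ∀ {j} → Walk (G ∖ m) a c j → 2 ≤ j
    two≤ here                  = ⊥-elim (a≢c refl)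
    two≤ (step (a∼c , _) here) = ⊥-elim (a≁c a∼c)
    two≤ (step _ (step _ _))   = s≤s (s≤s z≤n)

    four≤length : 4 ≤ suc (length (vertices P))
    four≤length rewrite length-vertices P = s≤s (s≤s (two≤ P))

    cycle : Cycle G
    cycle = record
      { start    = m
      ; rest     = vertices P
      ; distinct = avoids P a≢m ∷ shortest-unique P P-min
      ; enough   = ≤-trans (n≤1+n 3) four≤length
      ; closed   = linked-around (sym G a∼m) P (sym G m∼c)
      }

  detour-cycle : ∀ {x a c y z p q R i i′} →
    (∀ j → Walk G x y j → p + suc (suc q) ≤ j) →
    Walk G x a p → Adj G a m → Adj G m c → Walk G c y q →
    (∀ j → Walk G m z j → R ≤ j) →
    Walk G x z i → i < suc p + R →
    Walk G y z i′ → i′ < suc q + R →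
    CircumferenceAtLeast G 4
  detour-cycle {x} {y = y} {p = p} {q} geodesic x⇝a a∼m m∼c c⇝y far x⇝z x⇝z-short y⇝z y⇝z-short =
    cycle-through a∼m m∼c a≢c a≁c
      (reverseʷ x⇝a′ ++ʷ x⇝z′ ++ʷ reverseʷ y⇝z′ ++ʷ reverseʷ c⇝y′)
    where
    x⇝m-long : ∀ {j} → Walk G x m j → suc p ≤ j
    x⇝m-long {j} W = +-cancelʳ-≤ (suc q) (suc p) j
      (≤-trans (≤-reflexive (≡.sym (+-suc p (suc q)))) (geodesic _ (W ++ʷ step m∼c c⇝y)))

    m⇝y-long : ∀ {j} → Walk G m y j → suc q ≤ j
    m⇝y-long W = s≤s⁻¹ (+-cancelˡ-≤ p _ _ (geodesic _ (x⇝a ++ʷ step a∼m W)))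

    x⇝a′ : Walk (G ∖ m) x _ p
    x⇝a′ = avoid x⇝a λ {i} x⇝m _ → ≤-trans (x⇝m-long x⇝m) (m≤m+n i _)

    c⇝y′ : Walk (G ∖ m) _ y q
    c⇝y′ = avoid c⇝y λ {i} {j} _ m⇝y → ≤-trans (m⇝y-long m⇝y) (m≤n+m j i)

    x⇝z′ : Walk (G ∖ m) x _ _
    x⇝z′ = avoid x⇝z λ {_} {j} x⇝m m⇝z →
      <-≤-trans x⇝z-short (+-mono-≤ (x⇝m-long x⇝m) (far j m⇝z))

    y⇝z′ : Walk (G ∖ m) y _ _
    y⇝z′ = avoid y⇝z λ {_} {j} y⇝m m⇝z →
      <-≤-trans y⇝z-short (+-mono-≤ (m⇝y-long (reverseʷ y⇝m)) (far j m⇝z))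

    a≢c : _ ≢ _
    a≢c refl = <⇒≱ (+-monoʳ-< p (n≤1+n (suc q))) (geodesic _ (x⇝a ++ʷ c⇝y))

    a≁c : ¬ Adj G _ _
    a≁c a∼c = <⇒≱ (+-monoʳ-< p ≤-refl) (geodesic _ (x⇝a ++ʷ step a∼c c⇝y))

module Eccentricity {n : ℕ} {G : Graph n} (conn : Connected G) where

  dist : Fin n → Fin n → ℕ
  dist u v = proj₁ (shortest (proj₂ (conn u v)))

  dist-spec : ∀ u v → Dist G u v (dist u v)
  dist-spec u v = proj₂ (shortest (proj₂ (conn u v)))

  farthest : Fin n → Fin n
  farthest u = argmax (dist u) u (allFin n)

  ecc : Fin n → ℕ
  ecc u = dist u (farthest u)

  dist≤ecc : ∀ u v → dist u v ≤ ecc u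
  dist≤ecc u v = All.lookup (f[xs]≤f[argmax] {f = dist u} u (allFin n)) (∈-allFin v)

  ecc-spec : ∀ u → Ecc G u (ecc u)
  ecc-spec u =
    (λ v j d → ≤-trans (≤-reflexive (Dist-unique d (dist-spec u v))) (dist≤ecc u v)) ,
    farthest u , dist-spec u (farthest u)

  cycle-from-diametral-pair : ∀ {x y p q D R} →
    (∀ u → R ≤ ecc u) → (∀ u v → dist u v ≤ D) → Dist G x y D →
    p + suc (suc q) ≡ D → suc p < R → suc q < R →
    CircumferenceAtLeast G 4
  cycle-from-diametral-pair {x} {y} {p} {q} R≤ecc diameter (x⇝y , geodesic) refl p+1<R q+1<R
    with splitAtʷ p x⇝y
  ... | _ , x⇝a , step {w = m} a∼m (step m∼c c⇝y) =
    detour-cycle G m geodesic x⇝a a∼m m∼c c⇝y far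
      (proj₁ (dist-spec x z)) (≤-trans (s≤s (diameter x z)) (+-monoʳ-≤ (suc p) q+1<R))
      (proj₁ (dist-spec y z)) (≤-trans (s≤s (≤-trans (diameter y z) (≤-reflexive (swap p q))))
                                       (+-monoʳ-≤ (suc q) p+1<R))
    where
    z : Fin n
    z = farthest m

    far : ∀ j → Walk G m z j → _ ≤ j
    far j W = ≤-trans (R≤ecc m) (proj₂ (dist-spec m z) j W)

    swap : ∀ p q → p + suc (suc q) ≡ q + suc (suc p)
    swap = solve-∀

  cycle-from-short-diameter : ∀ {r} x → (∀ u → r ≤ ecc u) → (∀ u → ecc u + 2 ≤ 2 * r) →
                              (∀ u → ecc u ≤ ecc x) → CircumferenceAtLeast G 4
  cycle-from-short-diameter x r≤ecc ecc-short x-peripheral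
    with balanced-split (r≤ecc x) (ecc-short x)
  ... | _ , _ , split , p+1<r , q+1<r =
    cycle-from-diametral-pair r≤ecc diameter (dist-spec x (farthest x)) split p+1<r q+1<r
    where
    diameter : ∀ u v → dist u v ≤ ecc x
    diameter u v = ≤-trans (dist≤ecc u v) (x-peripheral u)

corollary2 : ∀ {n : ℕ} (G : Graph n) (r : ℕ) →
    Connected G → Radius G r →
    (∀ u k → Ecc G u k → k + 2 ≤ 2 * r) →
    CircumferenceAtLeast G 4
corollary2 {n} G r conn ((c , _) , r≤Ecc) Ecc-short =
  cycle-from-short-diameter x (λ u → r≤Ecc u _ (ecc-spec u)) (λ u → Ecc-short u _ (ecc-spec u))
    x-peripheral
  where
  open Eccentricity conn

  x : Fin n
  x = argmax ecc c (allFin n)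

  x-peripheral : ∀ u → ecc u ≤ ecc x
  x-peripheral u = All.lookup (f[xs]≤f[argmax] {f = ecc} c (allFin n)) (∈-allFin u)
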